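{- For every game with activeness $G^g$ there exists a unique canonical game $H^h$ with $G^g=H^h$.
   Context: Let $\mathcal{B}=\{0,1\}$. Define $\mathbb{I}_0=\{\emptyset\}\times\mathcal{B}$ and $\mathbb{I}_n=2^{\mathbb{I}_{n-1}}\times\mathcal{B}$ for $n\ge1$; a game with activeness is an element of $\mathbb{I}=\bigcup_{n\ge0}\mathbb{I}_n$ (uniqueness is as elements of $\mathbb{I}$). A pair $(G,g)$ is written $G^g$; the elements of $G$ are the options of $G^g$, $g=1$ meaning active. The outcome $o$ is defined recursively: $o(G^g)=\mathscr{N}$ if $g=1$ and some option has outcome $\mathscr{P}$, and $o(G^g)=\mathscr{P}$ otherwise. The sum is $G^g+H^h=(\{G'^{g'}+H^h:G'^{g'}\in G^g\}\cup\{G^g+H'^{h'}:H'^{h'}\in H^h\})^{\max\{g,h\}}$. $G^g=H^h$ means $o(G^g+X^x)=o(H^h+X^x)$ for all games $X^x$. An option $G'^{g'}$ of $G^g$ is reversible if there is an option $G''^{g''}\in G'^{g'}$ with $G''^{g''}=G^g$. A game is canonical (defined recursively) if every option of it is canonical and no option of it is reversible. -}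

module Defs where

open import Data.Bool using (Bool; true; false; _∨_; not)
open import Data.List using (List; []; _∷_; _++_)
open import Data.List.Relation.Unary.All using (All)
open import Data.List.Relation.Unary.Any using (Any)
open import Data.Product using (Σ; _×_)
open import Relation.Binary.PropositionalEquality using (_≡_)
open import Relation.Nullary using (¬_)

-- A game with activeness G^g: a finite set of options (represented by a
-- list; identity of games is hereditary extensional equality _≅_ below)
-- together with an activeness bit g (true = active).
data Game : Set where
  mk : List Game → Bool → Game

options : Game → List Game
options (mk Gs g) = Gs

active : Game → Bool
active (mk Gs g) = g

data _≅_ : Game → Game → Set where
  ext : ∀ {Gs Hs g h} → g ≡ h
      → All (λ G' → Any (λ H' → G' ≅ H') Hs) Gs
      → All (λ H' → Any (λ G' → G' ≅ H') Gs) Hs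
      → mk Gs g ≅ mk Hs h

mutual
  isP : Game → Bool
  isP (mk Gs true)  = not (anyP Gs)
  isP (mk Gs false) = true

  anyP : List Game → Bool
  anyP []       = false
  anyP (G ∷ Gs) = isP G ∨ anyP Gs

data Outcome : Set where
  𝒩 𝒫 : Outcome

o : Game → Outcome
o G with isP G
... | true  = 𝒫
... | false = 𝒩

mutual
  infixl 6 _+_
  _+_ : Game → Game → Game
  G@(mk Gs g) + H@(mk Hs h) = mk (addL Gs H ++ addR G Hs) (g ∨ h)

  addL : List Game → Game → List Game
  addL []        H = []
  addL (G' ∷ Gs) H = (G' + H) ∷ addL Gs H

  addR : Game → List Game → List Game
  addR G []        = []
  addR G (H' ∷ Hs) = (G + H') ∷ addR G Hs

infix 4 _≈_
_≈_ : Game → Game → Set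
G ≈ H = ∀ X → o (G + X) ≡ o (H + X)

Reversible : Game → Game → Set
Reversible G G' = Any (λ G'' → G'' ≈ G) (options G')

data Canonical : Game → Set where
  canonical : ∀ {Gs g}
            → All Canonical Gs
            → All (λ G' → ¬ Reversible (mk Gs g) G') Gs
            → Canonical (mk Gs g)

-- Two games are equal exactly when they have the same activeness, when active
-- either both or neither have an inactive option, and every option of either
-- game is equal to an option of the other or has an option equal to the other
-- game.  Sufficiency is an induction on the test game.  Necessity is
-- constructive: on finite games one either verifies these conditions or builds
-- a game telling the two apart, the basic ingredient being that G plus G with
-- every position made active is a 𝒫-position.  So equality is decidable.
--
-- A canonical form is obtained by canonicalising the options and then
-- bypassing reversible options one at a time (replacing G' by the options of
-- its reversing option G''), which preserves equality and decreases size.  Two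
-- equal canonical games are identical: the criterion matches their options
-- pairwise by induction, since the other alternative would make an option
-- reversible.

module Submission where

open import Defs
open import Data.Bool using (true; false; _∨_; not)
open import Data.Bool.Properties using (∨-zeroʳ; not-injective)
open import Data.Empty using (⊥; ⊥-elim)
open import Data.List using (List; []; _∷_; _++_; [_]; map)
open import Data.List.Membership.Propositional using (_∈_; find; lose)
open import Data.List.Membership.Propositional.Properties
  using (∈-map⁺; ∈-map⁻; ∈-++⁺ˡ; ∈-++⁺ʳ; ∈-++⁻; ∈-∃++)
open import Data.List.Relation.Binary.Subset.Propositional using (_⊆_)
open import Data.List.Relation.Unary.All as All using (All; []; _∷_)
open import Data.List.Relation.Unary.All.Properties as All using (¬Any⇒All¬)
open import Data.List.Relation.Unary.Any as Any using (Any; here; there; any?)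
open import Data.List.Relation.Unary.Any.Properties as Any using ()
open import Data.Nat as ℕ using (ℕ; suc; _<_; s≤s⁻¹)
open import Data.Nat.Properties
  using (n<1+n; +-assoc; <-trans; <-≤-trans; +-mono-<; +-monoˡ-<; +-monoʳ-<; m≤m+n; m≤n+m; ≤-trans
        ; module ≤-Reasoning)
open import Data.Product using (Σ; _×_; _,_; proj₁; proj₂; map₂)
open import Data.Sum using (_⊎_; inj₁; inj₂)
open import Function using (_∘_; id)
open import Relation.Binary.PropositionalEquality using (_≡_; refl; sym; trans; cong; cong₂)
open import Relation.Nullary using (¬_; Dec; yes; no)

Step : ∀ {ℓ} → (Game → Set ℓ) → Set ℓ
Step P = ∀ Gs g → (∀ {G'} → G' ∈ Gs → P G') → P (mk Gs g)

mutual
  game-ind : ∀ {ℓ} (P : Game → Set ℓ) → Step P → ∀ G → P G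
  game-ind P step (mk Gs g) = step Gs g (game-ind-∈ P step Gs)

  game-ind-∈ : ∀ {ℓ} (P : Game → Set ℓ) → Step P → ∀ Gs {G'} → G' ∈ Gs → P G'
  game-ind-∈ P step (G ∷ Gs) (here refl) = game-ind P step G
  game-ind-∈ P step (G ∷ Gs) (there m)   = game-ind-∈ P step Gs m

any-or-all : ∀ {A : Set} {P Q : A → Set} xs → (∀ {x} → x ∈ xs → P x ⊎ Q x) → Any P xs ⊎ All Q xs
any-or-all []       pq = inj₂ []
any-or-all (x ∷ xs) pq with pq (here refl) | any-or-all xs (pq ∘ there)
... | inj₁ p | _        = inj₁ (here p)
... | inj₂ q | inj₁ ps  = inj₁ (there ps)
... | inj₂ q | inj₂ qs  = inj₂ (q ∷ qs)

record Witnesses {A B : Set} (R : A → B → Set) (xs : List A) : Set where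
  field
    list     : List B
    complete : ∀ {x} → x ∈ xs → Any (R x) list
    sound    : ∀ {y} → y ∈ list → Any (λ x → R x y) xs

collect : ∀ {A B : Set} {R : A → B → Set} xs → (∀ {x} → x ∈ xs → Σ B (R x)) → Witnesses R xs
collect []       w = record { list = [] ; complete = λ () ; sound = λ () }
collect (x ∷ xs) w with w (here refl) | collect xs (w ∘ there)
... | y , r | ws = record { list = y ∷ list ; complete = complete′ ; sound = sound′ }
  where
  open Witnesses ws
  complete′ : ∀ {x′} → x′ ∈ x ∷ xs → Any _ (y ∷ list)
  complete′ (here refl) = here r
  complete′ (there m)   = there (complete m)
  sound′ : ∀ {y′} → y′ ∈ y ∷ list → Any _ (x ∷ xs)
  sound′ (here refl) = here r
  sound′ (there m)   = there (sound m)

-- Records rather than equations, so that the game can be inferred from the type.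
record Is𝒫 (A : Game) : Set where
  constructor is𝒫
  field isP≡true : isP A ≡ true

record Is𝒩 (A : Game) : Set where
  constructor is𝒩
  field isP≡false : isP A ≡ false

𝒫⇒¬𝒩 : ∀ {A} → Is𝒫 A → Is𝒩 A → ⊥
𝒫⇒¬𝒩 (is𝒫 p) (is𝒩 n) with () ← trans (sym p) n

𝒫-resp : ∀ {C D} → isP C ≡ isP D → Is𝒫 C → Is𝒫 D
𝒫-resp e (is𝒫 p) = is𝒫 (trans (sym e) p)

𝒩-resp : ∀ {C D} → isP C ≡ isP D → Is𝒩 C → Is𝒩 D
𝒩-resp e (is𝒩 n) = is𝒩 (trans (sym e) n)

isP-≡ : ∀ {C D} → (Is𝒩 C → Is𝒩 D) → (Is𝒩 D → Is𝒩 C) → isP C ≡ isP D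
isP-≡ {C} {D} f g with isP C in c | isP D in d
... | true  | true  = refl
... | false | false = refl
... | true  | false with () ← trans (sym c) (Is𝒩.isP≡false (g (is𝒩 d)))
... | false | true  with () ← trans (sym d) (Is𝒩.isP≡false (f (is𝒩 c)))

anyP⇒Any𝒫 : ∀ Gs → anyP Gs ≡ true → Any Is𝒫 Gs
anyP⇒Any𝒫 (G ∷ Gs) e with isP G in p
... | true  = here (is𝒫 p)
... | false = there (anyP⇒Any𝒫 Gs e)

Any𝒫⇒anyP : ∀ {Gs} → Any Is𝒫 Gs → anyP Gs ≡ true
Any𝒫⇒anyP (here (is𝒫 p)) rewrite p = refl
Any𝒫⇒anyP {G ∷ _} (there ps) rewrite Any𝒫⇒anyP ps = ∨-zeroʳ (isP G)

inactive⇒𝒫 : ∀ {A} → active A ≡ false → Is𝒫 A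
inactive⇒𝒫 {mk _ false} refl = is𝒫 refl

𝒩-intro : ∀ {A A'} → active A ≡ true → A' ∈ options A → Is𝒫 A' → Is𝒩 A
𝒩-intro {mk _ true} refl m p = is𝒩 (cong not (Any𝒫⇒anyP (lose m p)))

𝒩-elim : ∀ {A} → Is𝒩 A → active A ≡ true × Any Is𝒫 (options A)
𝒩-elim {mk Gs true} (is𝒩 n) = refl , anyP⇒Any𝒫 Gs (not-injective n)

𝒫-intro : ∀ {A} → (active A ≡ true → ∀ {A'} → A' ∈ options A → Is𝒩 A') → Is𝒫 A
𝒫-intro {mk Gs false} replies = is𝒫 refl
𝒫-intro {mk Gs true}  replies with anyP Gs in e
... | false = is𝒫 (cong not e)
... | true with find (anyP⇒Any𝒫 Gs e)
...   | _ , m , p with () ← 𝒫⇒¬𝒩 p (replies refl m)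

𝒫-elim : ∀ {A A'} → Is𝒫 A → active A ≡ true → A' ∈ options A → Is𝒩 A'
𝒫-elim {A' = A'} p a m with isP A' in e
... | false = is𝒩 e
... | true with () ← 𝒫⇒¬𝒩 p (𝒩-intro a m (is𝒫 e))

addL≡map : ∀ Gs H → addL Gs H ≡ map (_+ H) Gs
addL≡map []       H = refl
addL≡map (G ∷ Gs) H = cong (G + H ∷_) (addL≡map Gs H)

addR≡map : ∀ G Hs → addR G Hs ≡ map (G +_) Hs
addR≡map G []       = refl
addR≡map G (H ∷ Hs) = cong (G + H ∷_) (addR≡map G Hs)

options-+ : ∀ A X → options (A + X) ≡ map (_+ X) (options A) ++ map (A +_) (options X)
options-+ A@(mk Gs _) X@(mk Hs _) = cong₂ _++_ (addL≡map Gs X) (addR≡map A Hs)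

+-optionˡ : ∀ A X {A'} → A' ∈ options A → A' + X ∈ options (A + X)
+-optionˡ A X m rewrite options-+ A X = ∈-++⁺ˡ (∈-map⁺ (_+ X) m)

+-optionʳ : ∀ A X {X'} → X' ∈ options X → A + X' ∈ options (A + X)
+-optionʳ A X m rewrite options-+ A X = ∈-++⁺ʳ (map (_+ X) (options A)) (∈-map⁺ (A +_) m)

data SumOption (A X : Game) : Game → Set where
  left  : ∀ {A'} → A' ∈ options A → SumOption A X (A' + X)
  right : ∀ {X'} → X' ∈ options X → SumOption A X (A + X')

+-option⁻ : ∀ A X {Y} → Y ∈ options (A + X) → SumOption A X Y
+-option⁻ A X m rewrite options-+ A X with ∈-++⁻ (map (_+ X) (options A)) m
... | inj₁ mL with ∈-map⁻ (_+ X) mL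
...   | _ , mA , refl = left mA
+-option⁻ A X m | inj₂ mR with ∈-map⁻ (A +_) mR
...   | _ , mX , refl = right mX

+-activeˡ : ∀ A X → active A ≡ true → active (A + X) ≡ true
+-activeˡ (mk _ true) (mk _ _) refl = refl

+-activeʳ : ∀ A X → active X ≡ true → active (A + X) ≡ true
+-activeʳ (mk _ g) (mk _ true) refl = ∨-zeroʳ g

+-inactive : ∀ A X → active A ≡ false → active X ≡ false → active (A + X) ≡ false
+-inactive (mk _ false) (mk _ false) refl refl = refl

+-inactive⁻ : ∀ A X → active (A + X) ≡ false → active A ≡ false × active X ≡ false
+-inactive⁻ (mk _ false) (mk _ false) refl = refl , refl
+-inactive⁻ (mk _ false) (mk _ true)  ()
+-inactive⁻ (mk _ true)  (mk _ _)     ()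

+-active⁻ˡ : ∀ A X → active (A + X) ≡ true → active X ≡ false → active A ≡ true
+-active⁻ˡ (mk _ true)  (mk _ _)     _  _  = refl
+-active⁻ˡ (mk _ false) (mk _ false) () _

+-active-cong : ∀ A B X → active A ≡ active B → active (A + X) ≡ active (B + X)
+-active-cong (mk _ _) (mk _ _) (mk _ x) e = cong (_∨ x) e

+-𝒫-intro : ∀ A X
  → (∀ {A'} → A' ∈ options A → active (A' + X) ≡ true × Any (λ X' → Is𝒫 (A' + X')) (options X))
  → (∀ {X'} → X' ∈ options X → Is𝒩 (A + X'))
  → Is𝒫 (A + X)
+-𝒫-intro A X answer reply = 𝒫-intro (λ _ m → move (+-option⁻ A X m))
  where
  move : ∀ {Y} → SumOption A X Y → Is𝒩 Y
  move (right mX) = reply mX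
  move (left {A'} mA) with answer mA
  ... | act , ans with find ans
  ...   | _ , mX , p = 𝒩-intro act (+-optionʳ A' X mX) p

-- Mirroring

-- A with every position made active.
activate : Game → Game
activate A = A + mk [] true

activate-active : ∀ A → active (activate A) ≡ true
activate-active A = +-activeʳ A (mk [] true) refl

activate-option-𝒩 : ∀ A {A'} → A' ∈ options A → Is𝒫 (A' + activate A') → Is𝒩 (A + activate A')
activate-option-𝒩 A {A'} m =
  𝒩-intro (+-activeʳ A (activate A') (activate-active A')) (+-optionˡ A (activate A') m)

mirror : ∀ A → Is𝒫 (A + activate A)
mirror = game-ind _ step
  where
  step : Step (λ A → Is𝒫 (A + activate A))
  step Gs g ih = +-𝒫-intro A (activate A) answer reply
    where
    A = mk Gs g
    answer : ∀ {A'} → A' ∈ Gs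
           → active (A' + activate A) ≡ true × Any (λ Y → Is𝒫 (A' + Y)) (options (activate A))
    answer {A'} m = +-activeʳ A' (activate A) (activate-active A) , lose (+-optionˡ A (mk [] true) m) (ih m)
    reply : ∀ {Y} → Y ∈ options (activate A) → Is𝒩 (A + Y)
    reply m with +-option⁻ A (mk [] true) m
    ... | left mA = activate-option-𝒩 A mA (ih mA)

mirror-option-𝒩 : ∀ B {Y} → Y ∈ map activate (options B) → Is𝒩 (B + Y)
mirror-option-𝒩 B m with ∈-map⁻ activate m
... | B' , mB , refl = activate-option-𝒩 B mB (mirror B')

mirror-answer : ∀ B {Ys B'} → B' ∈ options B → map activate (options B) ⊆ Ys
              → Any (λ Y → Is𝒫 (B' + Y)) Ys
mirror-answer B m sub = lose (sub (∈-map⁺ activate m)) (mirror _)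

-- Separating games

record Separates (X A B : Game) : Set where
  constructor separates
  field
    𝒫-left  : Is𝒫 (A + X)
    𝒩-right : Is𝒩 (B + X)

Separated : Game → Game → Set
Separated A B = Σ Game λ X → Separates X A B

ActivelySeparated : Game → Game → Set
ActivelySeparated A B = Σ Game λ X → active X ≡ true × Separates X A B

separated-swap : ∀ {A B} → Separated A B → ActivelySeparated B A
separated-swap {A} {B} (X , separates 𝒫A 𝒩B) = Y , refl , separates 𝒫B 𝒩A
  where
  Y = mk (X ∷ map activate (options B)) true
  𝒩A : Is𝒩 (A + Y)
  𝒩A = 𝒩-intro (+-activeʳ A Y refl) (+-optionʳ A Y (here refl)) 𝒫A
  reply : ∀ {Y'} → Y' ∈ options Y → Is𝒩 (B + Y')
  reply (here refl) = 𝒩B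
  reply (there m)   = mirror-option-𝒩 B m
  𝒫B : Is𝒫 (B + Y)
  𝒫B = +-𝒫-intro B Y (λ {B'} m → +-activeʳ B' Y refl , mirror-answer B m there) reply

separated-sym : ∀ {A B} → Separated A B → Separated B A
separated-sym = map₂ proj₂ ∘ separated-swap

separated-active : ∀ {A B} → Separated A B → ActivelySeparated A B
separated-active = separated-swap ∘ separated-sym

separated-by-activity : ∀ {A B} → active A ≡ true → active B ≡ false → Separated B A
separated-by-activity {A} {B} a b =
  X , separates (inactive⇒𝒫 (+-inactive B X b refl))
                (𝒩-intro (+-activeˡ A X a) (+-optionʳ A X (here refl)) (mirror A))
  where X = mk [ activate A ] false

AnyInactive : List Game → Set
AnyInactive = Any (λ G → active G ≡ false)

AllActive : List Game → Set
AllActive = All (λ G → active G ≡ true)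

separated-by-inactive-option : ∀ {A B} → active A ≡ true → active B ≡ true
  → AnyInactive (options A) → AllActive (options B) → Separated B A
separated-by-inactive-option {A} {B} a b inactive allActive = X , separates 𝒫B 𝒩A
  where
  X = mk (map activate (options B)) false
  𝒫B : Is𝒫 (B + X)
  𝒫B = +-𝒫-intro B X (λ {B'} m → +-activeˡ B' X (All.lookup allActive m) , mirror-answer B m id)
                     (mirror-option-𝒩 B)
  𝒩A : Is𝒩 (A + X)
  𝒩A with find inactive
  ... | A₀ , m , i = 𝒩-intro (+-activeˡ A X a) (+-optionˡ A X m) (inactive⇒𝒫 (+-inactive A₀ X i refl))

-- The separating game offers, for every option of B and of A', a game
-- actively separating it from A' resp. B.
separated-by-unmatched-option : ∀ {A B A'} → A' ∈ options A
  → All (Separated A') (options B) → All (λ A'' → Separated A'' B) (options A') → Separated B A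
separated-by-unmatched-option {A} {B} {A'} mA' sepB sepA = X , separates 𝒫B 𝒩A
  where
  ws₁ = collect (options B) (separated-swap ∘ All.lookup sepB)
  ws₂ = collect (options A') (separated-active ∘ All.lookup sepA)
  open Witnesses ws₁ renaming (list to Ds₁; complete to complete₁; sound to sound₁)
  open Witnesses ws₂ renaming (list to Ds₂; complete to complete₂; sound to sound₂)
  X = mk (Ds₁ ++ Ds₂) true
  both-𝒩 : ∀ {D} → D ∈ Ds₁ ++ Ds₂ → Is𝒩 (A' + D) × Is𝒩 (B + D)
  both-𝒩 {D} m with ∈-++⁻ Ds₁ m
  ... | inj₁ m₁ with find (sound₁ m₁)
  ...   | _ , mB , act , separates p n = n , 𝒩-intro (+-activeʳ B D act) (+-optionˡ B D mB) p
  both-𝒩 {D} m | inj₂ m₂ with find (sound₂ m₂)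
  ...   | _ , mA'' , act , separates p n = 𝒩-intro (+-activeʳ A' D act) (+-optionˡ A' D mA'') p , n
  𝒫A' : Is𝒫 (A' + X)
  𝒫A' = +-𝒫-intro A' X
    (λ {A''} m → +-activeʳ A'' X refl , Any.++⁺ʳ Ds₁ (Any.map (Separates.𝒫-left ∘ proj₂) (complete₂ m)))
    (proj₁ ∘ both-𝒩)
  𝒩A : Is𝒩 (A + X)
  𝒩A = 𝒩-intro (+-activeʳ A X refl) (+-optionˡ A X mA') 𝒫A'
  𝒫B : Is𝒫 (B + X)
  𝒫B = +-𝒫-intro B X
    (λ {B'} m → +-activeʳ B' X refl , Any.++⁺ˡ (Any.map (Separates.𝒫-left ∘ proj₂) (complete₁ m)))
    (proj₂ ∘ both-𝒩)

-- The criterion for equality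

-- The relation _≈_ stated through isP, again as a record for inference.
infix 4 _≋_
record _≋_ (A B : Game) : Set where
  constructor mk≋
  field same-isP : ∀ X → isP (A + X) ≡ isP (B + X)
open _≋_

≋-refl : ∀ {A} → A ≋ A
≋-refl = mk≋ (λ _ → refl)

≋-sym : ∀ {A B} → A ≋ B → B ≋ A
≋-sym e = mk≋ (λ X → sym (same-isP e X))

≋-trans : ∀ {A B C} → A ≋ B → B ≋ C → A ≋ C
≋-trans e f = mk≋ (λ X → trans (same-isP e X) (same-isP f X))

≋-𝒫 : ∀ {A B} → A ≋ B → ∀ X → Is𝒫 (A + X) → Is𝒫 (B + X)
≋-𝒫 e X = 𝒫-resp (same-isP e X)

≋-𝒩 : ∀ {A B} → A ≋ B → ∀ X → Is𝒩 (A + X) → Is𝒩 (B + X)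
≋-𝒩 e X = 𝒩-resp (same-isP e X)

isP≡⇒o≡ : ∀ C D → isP C ≡ isP D → o C ≡ o D
isP≡⇒o≡ C D e with isP C | isP D
isP≡⇒o≡ C D refl | true  | true  = refl
isP≡⇒o≡ C D refl | false | false = refl

o≡⇒isP≡ : ∀ C D → o C ≡ o D → isP C ≡ isP D
o≡⇒isP≡ C D e with isP C | isP D
... | true  | true  = refl
... | false | false = refl
o≡⇒isP≡ C D () | true  | false
o≡⇒isP≡ C D () | false | true

≋⇒≈ : ∀ {A B} → A ≋ B → A ≈ B
≋⇒≈ {A} {B} e X = isP≡⇒o≡ (A + X) (B + X) (same-isP e X)

≈⇒≋ : ∀ {A B} → A ≈ B → A ≋ B
≈⇒≋ {A} {B} e = mk≋ (λ X → o≡⇒isP≡ (A + X) (B + X) (e X))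

separated⇒≉ : ∀ {A B} → Separated A B → ¬ A ≋ B
separated⇒≉ (X , separates p n) e = 𝒫⇒¬𝒩 (≋-𝒫 e X p) n

record ActivityAgrees (A B : Game) : Set where
  field
    same-active      : active A ≡ active B
    inactive-optionˡ : active A ≡ true → AnyInactive (options A) → AnyInactive (options B)
    inactive-optionʳ : active A ≡ true → AnyInactive (options B) → AnyInactive (options A)

Matched : Game → Game → Set
Matched A B = All (λ A' → Any (A' ≋_) (options B) ⊎ Any (_≋ B) (options A')) (options A)

record Criterion (A B : Game) : Set where
  field
    activity : ActivityAgrees A B
    matchedˡ : Matched A B
    matchedʳ : Matched B A

activity-sym : ∀ {A B} → ActivityAgrees A B → ActivityAgrees B A
activity-sym act = record
  { same-active      = sym same-active
  ; inactive-optionˡ = inactive-optionʳ ∘ trans same-active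
  ; inactive-optionʳ = inactive-optionˡ ∘ trans same-active
  }
  where open ActivityAgrees act

module _ {A B : Game} (act : ActivityAgrees A B) (matched : Matched A B) where
  open ActivityAgrees act

  𝒩-transfer : ∀ X → (∀ {X'} → X' ∈ options X → isP (A + X') ≡ isP (B + X'))
             → Is𝒩 (A + X) → Is𝒩 (B + X)
  𝒩-transfer X ih 𝒩AX with 𝒩-elim 𝒩AX
  ... | actAX , win with find win
  ...   | _ , m , p = move (+-option⁻ A X m) p
    where
    actBX : active (B + X) ≡ true
    actBX = trans (sym (+-active-cong A B X same-active)) actAX
    move : ∀ {Y} → SumOption A X Y → Is𝒫 Y → Is𝒩 (B + X)
    move (right mX) p = 𝒩-intro actBX (+-optionʳ B X mX) (𝒫-resp (ih mX) p)
    move (left {A'} mA) p with All.lookup matched mA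
    ... | inj₁ equal with find equal
    ...   | B' , mB , e = 𝒩-intro actBX (+-optionˡ B X mB) (≋-𝒫 e X p)
    move (left {A'} mA) p | inj₂ reversing with find reversing | active (A' + X) in actA'X
    ... | A'' , mA'' , e | true = ≋-𝒩 e X (𝒫-elim p actA'X (+-optionˡ A' X mA''))
    ... | _ | false with +-inactive⁻ A' X actA'X
    ...   | inactiveA' , inactiveX with find (inactive-optionˡ (+-active⁻ˡ A X actAX inactiveX) (lose mA inactiveA'))
    ...     | B₀ , mB₀ , inactiveB₀ =
                𝒩-intro actBX (+-optionˡ B X mB₀) (inactive⇒𝒫 (+-inactive B₀ X inactiveB₀ inactiveX))

criterion⇒≋ : ∀ {A B} → Criterion A B → A ≋ B
criterion⇒≋ {A} {B} c = mk≋ (game-ind _ step)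
  where
  open Criterion c
  step : Step (λ X → isP (A + X) ≡ isP (B + X))
  step Xs x ih = isP-≡ (𝒩-transfer activity matchedˡ X ih)
                       (𝒩-transfer (activity-sym activity) matchedʳ X (sym ∘ ih))
    where X = mk Xs x

-- Deciding the criterion

mutual
  size : Game → ℕ
  size (mk Gs _) = suc (sizes Gs)

  sizes : List Game → ℕ
  sizes []       = 0
  sizes (G ∷ Gs) = size G ℕ.+ sizes Gs

size≤sizes : ∀ {G Gs} → G ∈ Gs → size G ℕ.≤ sizes Gs
size≤sizes {Gs = G ∷ Gs} (here refl) = m≤m+n (size G) (sizes Gs)
size≤sizes {Gs = G ∷ Gs} (there m)   = ≤-trans (size≤sizes m) (m≤n+m (sizes Gs) (size G))

size-option : ∀ A {A'} → A' ∈ options A → size A' < size A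
size-option (mk _ _) m = ℕ.s≤s (size≤sizes m)

Decision : Game → Game → Set
Decision A B = Criterion A B ⊎ Separated A B

decision⇒≋? : ∀ {A B} → Decision A B → A ≋ B ⊎ Separated A B
decision⇒≋? (inj₁ c) = inj₁ (criterion⇒≋ c)
decision⇒≋? (inj₂ s) = inj₂ s

decision⇒≋?-sym : ∀ {A B} → Decision A B → B ≋ A ⊎ Separated B A
decision⇒≋?-sym (inj₁ c) = inj₁ (≋-sym (criterion⇒≋ c))
decision⇒≋?-sym (inj₂ s) = inj₂ (separated-sym s)

inactive-or-active : ∀ Gs → AnyInactive Gs ⊎ AllActive Gs
inactive-or-active Gs = any-or-all Gs (λ {G} _ → dichotomy (active G))
  where
  dichotomy : ∀ b → b ≡ false ⊎ b ≡ true
  dichotomy false = inj₁ refl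
  dichotomy true  = inj₂ refl

inactive-contradiction : ∀ {Gs} → AllActive Gs → AnyInactive Gs → ⊥
inactive-contradiction allActive inactive with All.lookupAny allActive inactive
... | t , f with () ← trans (sym t) f

activity? : ∀ A B → ActivityAgrees A B ⊎ Separated A B
activity? A B with active A in a | active B in b
... | true  | false = inj₂ (separated-sym (separated-by-activity a b))
... | false | true  = inj₂ (separated-by-activity b a)
... | false | false = inj₁ record
  { same-active      = trans a (sym b)
  ; inactive-optionˡ = λ t → ⊥-elim (true≢false (trans (sym t) a))
  ; inactive-optionʳ = λ t → ⊥-elim (true≢false (trans (sym t) a))
  }
  where
  true≢false : true ≡ false → ⊥
  true≢false ()
... | true | true with inactive-or-active (options A) | inactive-or-active (options B)
...   | inj₁ iA | inj₂ aB = inj₂ (separated-sym (separated-by-inactive-option a b iA aB))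
...   | inj₂ aA | inj₁ iB = inj₂ (separated-by-inactive-option b a iB aA)
...   | inj₁ iA | inj₁ iB = inj₁ record
  { same-active = trans a (sym b) ; inactive-optionˡ = λ _ _ → iB ; inactive-optionʳ = λ _ _ → iA }
...   | inj₂ aA | inj₂ aB = inj₁ record
  { same-active      = trans a (sym b)
  ; inactive-optionˡ = λ _ iA → ⊥-elim (inactive-contradiction aA iA)
  ; inactive-optionʳ = λ _ iB → ⊥-elim (inactive-contradiction aB iB)
  }

matching : ∀ A B
  → (∀ {A' B'} → A' ∈ options A → B' ∈ options B → A' ≋ B' ⊎ Separated A' B')
  → (∀ {A' A''} → A' ∈ options A → A'' ∈ options A' → A'' ≋ B ⊎ Separated A'' B)
  → Matched A B ⊎ Separated B A
matching A B compare₁ compare₂ with any-or-all (options A) option-matched?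
  where
  option-matched? : ∀ {A'} → A' ∈ options A
    → (All (Separated A') (options B) × All (λ A'' → Separated A'' B) (options A'))
      ⊎ (Any (A' ≋_) (options B) ⊎ Any (_≋ B) (options A'))
  option-matched? mA with any-or-all _ (compare₁ mA)
  ... | inj₁ equal = inj₂ (inj₁ equal)
  ... | inj₂ sepB with any-or-all _ (compare₂ mA)
  ...   | inj₁ reversing = inj₂ (inj₂ reversing)
  ...   | inj₂ sepA      = inj₁ (sepB , sepA)
... | inj₂ matched = inj₁ matched
... | inj₁ unmatched with find unmatched
...   | _ , mA , sepB , sepA = inj₂ (separated-by-unmatched-option mA sepB sepA)

decide-step : ∀ A B → (∀ C D → size C ℕ.+ size D < size A ℕ.+ size B → Decision C D) → Decision A B
decide-step A B decide-smaller with activity? A B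
... | inj₂ s = inj₂ s
... | inj₁ act with matching A B compare-options compare-reversingˡ
  where
  compare-options : ∀ {A' B'} → A' ∈ options A → B' ∈ options B → A' ≋ B' ⊎ Separated A' B'
  compare-options mA mB = decision⇒≋? (decide-smaller _ _ (+-mono-< (size-option A mA) (size-option B mB)))
  compare-reversingˡ : ∀ {A' A''} → A' ∈ options A → A'' ∈ options A' → A'' ≋ B ⊎ Separated A'' B
  compare-reversingˡ mA mA'' =
    decision⇒≋? (decide-smaller _ _ (+-monoˡ-< (size B) (<-trans (size-option _ mA'') (size-option A mA))))
... | inj₂ s = inj₂ (separated-sym s)
... | inj₁ matchedˡ with matching B A compare-options compare-reversingʳ
  where
  compare-options : ∀ {B' A'} → B' ∈ options B → A' ∈ options A → B' ≋ A' ⊎ Separated B' A'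
  compare-options mB mA = decision⇒≋?-sym (decide-smaller _ _ (+-mono-< (size-option A mA) (size-option B mB)))
  compare-reversingʳ : ∀ {B' B''} → B' ∈ options B → B'' ∈ options B' → B'' ≋ A ⊎ Separated B'' A
  compare-reversingʳ mB mB'' =
    decision⇒≋?-sym (decide-smaller _ _ (+-monoʳ-< (size A) (<-trans (size-option _ mB'') (size-option B mB))))
...   | inj₂ s        = inj₂ s
...   | inj₁ matchedʳ = inj₁ record { activity = act ; matchedˡ = matchedˡ ; matchedʳ = matchedʳ }

decide-within : ∀ n A B → size A ℕ.+ size B < n → Decision A B
decide-within (suc n) A B bound =
  decide-step A B (λ C D smaller → decide-within n C D (<-≤-trans smaller (s≤s⁻¹ bound)))

decide : ∀ A B → Decision A B
decide A B = decide-within _ A B (n<1+n _)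

≋⇒criterion : ∀ {A B} → A ≋ B → Criterion A B
≋⇒criterion {A} {B} e with decide A B
... | inj₁ c = c
... | inj₂ s with () ← separated⇒≉ s e

≋-active : ∀ {A B} → A ≋ B → active A ≡ active B
≋-active = ActivityAgrees.same-active ∘ Criterion.activity ∘ ≋⇒criterion

_≋?_ : ∀ A B → Dec (A ≋ B)
A ≋? B with decide A B
... | inj₁ c = yes (criterion⇒≋ c)
... | inj₂ s = no (separated⇒≉ s)

-- Uniqueness of canonical forms

options-canonical : ∀ {G} → Canonical G → All Canonical (options G)
options-canonical (canonical cs _) = cs

canonical-unique : ∀ {A B} → Canonical A → Canonical B → A ≋ B → A ≅ B
canonical-unique {A} {B} = game-ind P step A B
  where
  P : Game → Set
  P A = ∀ B → Canonical A → Canonical B → A ≋ B → A ≅ B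
  step : Step P
  step As _ ih (mk Bs _) (canonical cAs irrA) (canonical cBs irrB) e =
    ext (ActivityAgrees.same-active activity) (All.tabulate matchˡ) (All.tabulate matchʳ)
    where
    open Criterion (≋⇒criterion e)
    matchˡ : ∀ {A'} → A' ∈ As → Any (A' ≅_) Bs
    matchˡ m with All.lookup matchedˡ m
    ... | inj₂ reversing =
      ⊥-elim (All.lookup irrA m (Any.map (λ e'' → ≋⇒≈ (≋-trans e'' (≋-sym e))) reversing))
    ... | inj₁ equal with find equal
    ...   | B' , mB , e' = lose mB (ih m B' (All.lookup cAs m) (All.lookup cBs mB) e')
    matchʳ : ∀ {B'} → B' ∈ Bs → Any (_≅ B') As
    matchʳ m with All.lookup matchedʳ m
    ... | inj₂ reversing = ⊥-elim (All.lookup irrB m (Any.map (λ e'' → ≋⇒≈ (≋-trans e'' e)) reversing))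
    ... | inj₁ equal with find equal
    ...   | A' , mA , e' = lose mA (ih mA _ (All.lookup cAs mA) (All.lookup cBs m) (≋-sym e'))

-- Existence of canonical forms

≋-options : ∀ {Gs Hs} g
          → (∀ {G'} → G' ∈ Gs → Any (G' ≋_) Hs) → (∀ {H'} → H' ∈ Hs → Any (H' ≋_) Gs)
          → mk Gs g ≋ mk Hs g
≋-options g cover covered = criterion⇒≋ record
  { activity = record
    { same-active      = refl
    ; inactive-optionˡ = λ _ → inactive-transfer cover
    ; inactive-optionʳ = λ _ → inactive-transfer covered
    }
  ; matchedˡ = All.tabulate (inj₁ ∘ cover)
  ; matchedʳ = All.tabulate (inj₁ ∘ covered)
  }
  where
  inactive-transfer : ∀ {Xs Ys} → (∀ {X} → X ∈ Xs → Any (X ≋_) Ys) → AnyInactive Xs → AnyInactive Ys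
  inactive-transfer cov inactive with find inactive
  ... | _ , m , i with find (cov m)
  ...   | _ , m' , e = lose m' (trans (sym (≋-active e)) i)

-- A winning move from either sum is found in the other one, directly or via K'' + X.
bypass : ∀ {Gs Ks g K''} → K'' ≋ mk Gs g → options K'' ⊆ Ks → Ks ⊆ Gs ++ options K'' → mk Gs g ≋ mk Ks g
bypass {Gs} {Ks} {g} {K''} e sub sup = mk≋ (game-ind _ step)
  where
  G = mk Gs g
  K = mk Ks g
  step : Step (λ X → isP (G + X) ≡ isP (K + X))
  step Xs x ih = isP-≡ G⇒K K⇒G
    where
    X = mk Xs x
    G⇒K : Is𝒩 (G + X) → Is𝒩 (K + X)
    G⇒K 𝒩GX with 𝒩-elim (≋-𝒩 (≋-sym e) X 𝒩GX)
    ... | _ , win with find win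
    ...   | _ , m , p with +-option⁻ K'' X m
    ...     | left mK       = 𝒩-intro (proj₁ (𝒩-elim 𝒩GX)) (+-optionˡ K X (sub mK)) p
    ...     | right {X'} mX =
      𝒩-intro (proj₁ (𝒩-elim 𝒩GX)) (+-optionʳ K X mX) (𝒫-resp (ih mX) (≋-𝒫 e X' p))
    K⇒G : Is𝒩 (K + X) → Is𝒩 (G + X)
    K⇒G 𝒩KX with 𝒩-elim 𝒩KX
    ... | act , win with find win
    ...   | _ , m , p with +-option⁻ K X m
    ...     | right mX = 𝒩-intro act (+-optionʳ G X mX) (𝒫-resp (sym (ih mX)) p)
    ...     | left mK with ∈-++⁻ Gs (sup mK)
    ...       | inj₁ mG   = 𝒩-intro act (+-optionˡ G X mG) p
    ...       | inj₂ mK'' = ≋-𝒩 e X (𝒩-intro actK''X (+-optionˡ K'' X mK'') p)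
      where
      actK''X : active (K'' + X) ≡ true
      actK''X = trans (+-active-cong K'' G X (≋-active e)) act

sizes-++ : ∀ L M → sizes (L ++ M) ≡ sizes L ℕ.+ sizes M
sizes-++ []      M = refl
sizes-++ (G ∷ L) M = trans (cong (size G ℕ.+_) (sizes-++ L M)) (sym (+-assoc (size G) (sizes L) (sizes M)))

module _ (L R : List Game) {K' K''} (mK'' : K'' ∈ options K') where

  bypass-smaller : sizes (L ++ options K'' ++ R) < sizes (L ++ K' ∷ R)
  bypass-smaller = begin-strict
    sizes (L ++ options K'' ++ R)              ≡⟨ sizes-++ L _ ⟩
    sizes L ℕ.+ sizes (options K'' ++ R)       ≡⟨ cong (sizes L ℕ.+_) (sizes-++ (options K'') R) ⟩
    sizes L ℕ.+ (sizes (options K'') ℕ.+ sizes R)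
      <⟨ +-monoʳ-< (sizes L) (+-monoˡ-< (sizes R) (<-trans (sizes-options K'') (size-option K' mK''))) ⟩
    sizes L ℕ.+ (size K' ℕ.+ sizes R)          ≡⟨ sizes-++ L (K' ∷ R) ⟨
    sizes (L ++ K' ∷ R)                        ∎
    where
    open ≤-Reasoning
    sizes-options : ∀ G → sizes (options G) < size G
    sizes-options (mk Gs _) = n<1+n (sizes Gs)

  bypass-canonical : All Canonical (L ++ K' ∷ R) → All Canonical (L ++ options K'' ++ R)
  bypass-canonical cs with All.++⁻ L cs
  ... | cL , cK' ∷ cR = All.++⁺ cL (All.++⁺ (options-canonical (All.lookup (options-canonical cK') mK'')) cR)

  bypass-reversible : ∀ {g} → K'' ≋ mk (L ++ K' ∷ R) g → mk (L ++ K' ∷ R) g ≋ mk (L ++ options K'' ++ R) g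
  bypass-reversible e = bypass e (∈-++⁺ʳ L ∘ ∈-++⁺ˡ) sup
    where
    sup : L ++ options K'' ++ R ⊆ (L ++ K' ∷ R) ++ options K''
    sup m with ∈-++⁻ L m
    ... | inj₁ mL = ∈-++⁺ˡ (∈-++⁺ˡ mL)
    ... | inj₂ m' with ∈-++⁻ (options K'') m'
    ...   | inj₁ mK = ∈-++⁺ʳ (L ++ K' ∷ R) mK
    ...   | inj₂ mR = ∈-++⁺ˡ (∈-++⁺ʳ L (there mR))

HasReversible : Game → Set
HasReversible G = Any (λ G' → Any (_≋ G) (options G')) (options G)

reversible? : ∀ G → Dec (HasReversible G)
reversible? G = any? (λ G' → any? (_≋? G) (options G')) (options G)

canonical-of-irreversible : ∀ {Ks g} → All Canonical Ks → ¬ HasReversible (mk Ks g) → Canonical (mk Ks g)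
canonical-of-irreversible {Ks} cs none =
  canonical cs (All.map (λ ¬rev rev → ¬rev (Any.map ≈⇒≋ rev)) (¬Any⇒All¬ Ks none))

remove-reversible : ∀ n g Ks → sizes Ks < n → All Canonical Ks → Σ Game λ H → Canonical H × mk Ks g ≋ H
remove-reversible (suc n) g Ks bound cs with reversible? (mk Ks g)
... | no none = mk Ks g , canonical-of-irreversible cs none , ≋-refl
... | yes some with find some
...   | K' , mK' , reversing with find reversing | ∈-∃++ mK'
...     | K'' , mK'' , e | L , R , refl
  with remove-reversible n g (L ++ options K'' ++ R)
         (<-≤-trans (bypass-smaller L R mK'') (s≤s⁻¹ bound)) (bypass-canonical L R mK'' cs)
...       | H , cH , e' = H , cH , ≋-trans (bypass-reversible L R mK'' e) e'

canonicalise-options : ∀ Gs g → (∀ {G'} → G' ∈ Gs → Σ Game λ H → Canonical H × G' ≋ H)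
                     → Σ (List Game) λ Hs → All Canonical Hs × mk Gs g ≋ mk Hs g
canonicalise-options Gs g canon =
  list , All.tabulate (proj₁ ∘ proj₂ ∘ Any.satisfied ∘ sound) ,
  ≋-options g (Any.map proj₂ ∘ complete) (Any.map (≋-sym ∘ proj₂) ∘ sound)
  where open Witnesses (collect Gs canon)

canonical-form : ∀ G → Σ Game λ H → Canonical H × G ≋ H
canonical-form = game-ind _ step
  where
  step : Step (λ G → Σ Game λ H → Canonical H × G ≋ H)
  step Gs g ih with canonicalise-options Gs g ih
  ... | Hs , cHs , e with remove-reversible _ g Hs (n<1+n _) cHs
  ...   | H , cH , e' = H , cH , ≋-trans e e'

theorem3p37 : (G : Game) →
    Σ Game (λ H → Canonical H × G ≈ H × ((H' : Game) → Canonical H' → G ≈ H' → H' ≅ H))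
theorem3p37 G with canonical-form G
... | H , cH , e = H , cH , ≋⇒≈ e , λ H' cH' e' → canonical-unique cH' cH (≋-trans (≋-sym (≈⇒≋ e')) e)
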